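{- For every integer $n\ge 3$, the closed helm graph $\mathrm{CH}_n$ is Fibonacci cordial.
   Context: The Fibonacci numbers are defined by $F_0=0$, $F_1=F_2=1$, $F_n=F_{n-1}+F_{n-2}$. For a graph $G$ with $N$ vertices, a Fibonacci cordial labeling is an injective function $f:V(G)\to\{F_0,F_1,\dots,F_N\}$ (labels $F_i$ with distinct indices are regarded as distinct labels) such that the induced edge labeling $f^*(uv)=(f(u)+f(v)) \bmod 2$ satisfies $|\varepsilon_0-\varepsilon_1|\le 1$, where $\varepsilon_i$ is the number of edges labeled $i$. A graph admitting such a labeling is called Fibonacci cordial. The helm $H_n$ is obtained from the wheel with apex $v$ and rim cycle $v_1\cdots v_nv_1$ by attaching a pendant vertex $u_i$ to each $v_i$. The closed helm $\mathrm{CH}_n$ is obtained from $H_n$ by adding the edges $u_iu_{i+1}$ ($1\le i\le n$, indices mod $n$), so that the $u_i$ form a cycle; it has $2n+1$ vertices and $4n$ edges. -}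

module Defs where

open import Data.Nat using (ℕ; zero; suc; _+_; _≤_; _%_; _≡ᵇ_)
open import Data.Nat.DivMod using (m%n<n)
open import Data.Fin using (Fin; toℕ; fromℕ<; _↑ˡ_; _↑ʳ_)
open import Data.List using (List; []; _∷_; length; filterᵇ; concatMap)
open import Data.List using (allFin) public
open import Data.Product using (_×_; _,_; Σ; proj₁; proj₂)
open import Function.Definitions using (Injective)
open import Relation.Binary.PropositionalEquality using (_≡_)

fib : ℕ → ℕ
fib zero = 0
fib (suc zero) = 1
fib (suc (suc n)) = fib (suc n) + fib n

record Graph : Set where
  field
    order : ℕ
    edges : List (Fin order × Fin order)
open Graph public

edgeLabel : (G : Graph) → (Fin (order G) → Fin (suc (order G))) →
            Fin (order G) × Fin (order G) → ℕ
edgeLabel G f (u , v) = (fib (toℕ (f u)) + fib (toℕ (f v))) % 2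

ε : (G : Graph) → (Fin (order G) → Fin (suc (order G))) → ℕ → ℕ
ε G f j = length (filterᵇ (λ e → edgeLabel G f e ≡ᵇ j) (edges G))

-- Fibonacci cordial labeling: injective f : V → {F_0,…,F_N} (identified with
-- indices 0..N, distinct indices = distinct labels), with |ε₀ - ε₁| ≤ 1.
IsFibonacciCordialLabeling : (G : Graph) → (Fin (order G) → Fin (suc (order G))) → Set
IsFibonacciCordialLabeling G f =
  Injective _≡_ _≡_ f × (ε G f 0 ≤ suc (ε G f 1)) × (ε G f 1 ≤ suc (ε G f 0))

FibonacciCordial : Graph → Set
FibonacciCordial G = Σ (Fin (order G) → Fin (suc (order G))) (IsFibonacciCordialLabeling G)

next : ∀ {n} → Fin n → Fin n
next {suc m} i = fromℕ< (m%n<n (suc (toℕ i)) (suc m))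

-- Closed helm CH_n on vertex set Fin (1 + (n + n)):
-- apex v = 0, rim v_i = 1 + i, pendant u_i = 1 + n + i  (i : Fin n).
apex : ∀ n → Fin (suc (n + n))
apex n = Fin.zero

rim : ∀ n → Fin n → Fin (suc (n + n))
rim n i = Fin.suc (i ↑ˡ n)

pendant : ∀ n → Fin n → Fin (suc (n + n))
pendant n i = Fin.suc (n ↑ʳ i)

closedHelm : ℕ → Graph
closedHelm n = record
  { order = suc (n + n)
  ; edges = concatMap
      (λ i → (apex n , rim n i)
           ∷ (rim n i , rim n (next i))
           ∷ (rim n i , pendant n i)
           ∷ (pendant n i , pendant n (next i))
           ∷ [])
      (allFin n)
  }

-- F_k is even exactly when 3 ∣ k, so only the indices of the labels modulo 3 matter.  Write
-- n = 3 + 3q + r with r < 3 and label the apex F_0, the rim vertex v_i with F_(i+2) and the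
-- pendant u_i with F_(n+2+ρʳ(i)), where ρ is the cyclic predecessor on Fin n.  As n ≡ r (mod 3),
-- u_i then has the parity of v_i except for i < r.  Split the edges into the n sectors
-- {vv_i, v_iv_(i+1), v_iu_i, u_iu_(i+1)}.  For 2 ≤ i < n - 1 the labels of sector i depend only
-- on i mod 3, and a full period carries six edges of each label.  What remains (sectors 0 and 1,
-- the r sectors after the last full period, and the seam sector n - 1) depends only on r, and
-- for each r < 3 it is balanced by evaluation.
module Submission where

open import Defs
open import Data.Nat using (ℕ; _≤_)
open import Data.Bool using (Bool; true; false; if_then_else_)
open import Data.Fin using (Fin; zero; suc; toℕ; fromℕ; inject₁; _↑ˡ_; _↑ʳ_; splitAt; join)
open import Data.Fin.Properties
  using (toℕ-injective; toℕ-inject₁; toℕ-fromℕ; toℕ-fromℕ<; toℕ<n; toℕ-↑ˡ; toℕ-↑ʳ; fromℕ≢inject₁;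
         inject₁-injective; suc-injective; splitAt-↑ˡ; splitAt-↑ʳ; splitAt-join; join-splitAt)
open import Data.List using (List; []; _∷_; _++_; length; map; filterᵇ; concatMap; tabulate)
open import Data.List.Properties using (filter-++; length-++; map-cong; map-concatMap)
open import Data.Nat.Base using (zero; suc; _+_; _*_; _∸_; _%_; _/_; _≡ᵇ_; _<_; s≤s; s≤s⁻¹)
open import Data.Nat.DivMod using (%-distribˡ-+; m<n⇒m%n≡m; n%n≡0; m%n<n; m≡m%n+[m/n]*n)
open import Data.Nat.Properties
  using (+-0-monoid; +-assoc; +-comm; +-suc; +-identityʳ; _<?_; ≤-reflexive; ≤-trans; ≤⇒≯; ≮⇒≥;
         m≤n⇒m≤1+n; m≤m+n; m≤n+m; m+[n∸m]≡n)
open import Data.Nat.Tactic.RingSolver using (solve-∀)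
open import Data.Product using (_×_; _,_; proj₁; proj₂)
open import Data.Sum using (inj₁; inj₂; map₂)
open import Data.Sum.Properties using (inj₁-injective; inj₂-injective)
open import Function using (_∘_; id; Injective)
open import Relation.Binary.PropositionalEquality
open import Relation.Nullary using (does; yes; no; contradiction)
open import Relation.Nullary.Decidable using (dec-true; dec-false)
open import Algebra.Properties.Monoid.Sum +-0-monoid using (sum-syntax; sum-cong-≗; sum-init-last)

open ≡-Reasoning

fibParity : ℕ → ℕ
fibParity 0 = 0
fibParity 1 = 1
fibParity 2 = 1
fibParity (suc (suc (suc n))) = fibParity n

fibParity-recurrence : ∀ n → (fibParity (suc n) + fibParity n) % 2 ≡ fibParity (suc (suc n))
fibParity-recurrence 0 = refl
fibParity-recurrence 1 = refl
fibParity-recurrence 2 = refl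
fibParity-recurrence (suc (suc (suc n))) = fibParity-recurrence n

fib%2≡fibParity : ∀ n → fib n % 2 ≡ fibParity n
fib%2≡fibParity 0 = refl
fib%2≡fibParity 1 = refl
fib%2≡fibParity (suc (suc n)) = begin
  (fib (suc n) + fib n) % 2              ≡⟨ %-distribˡ-+ (fib (suc n)) (fib n) 2 ⟩
  (fib (suc n) % 2 + fib n % 2) % 2
    ≡⟨ cong₂ (λ a b → (a + b) % 2) (fib%2≡fibParity (suc n)) (fib%2≡fibParity n) ⟩
  (fibParity (suc n) + fibParity n) % 2  ≡⟨ fibParity-recurrence n ⟩
  fibParity (suc (suc n))                ∎

fibParity-periodic : ∀ q m → fibParity (q * 3 + m) ≡ fibParity m
fibParity-periodic zero    m = refl
fibParity-periodic (suc q) m = fibParity-periodic q m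

count : ℕ → List ℕ → ℕ
count j xs = length (filterᵇ (_≡ᵇ j) xs)

length-filterᵇ-map : ∀ {A B : Set} (p : B → Bool) (g : A → B) xs →
                     length (filterᵇ (p ∘ g) xs) ≡ length (filterᵇ p (map g xs))
length-filterᵇ-map p g [] = refl
length-filterᵇ-map p g (x ∷ xs) with p (g x)
... | true  = cong suc (length-filterᵇ-map p g xs)
... | false = length-filterᵇ-map p g xs

count-++ : ∀ j xs ys → count j (xs ++ ys) ≡ count j xs + count j ys
count-++ j xs ys = trans (cong length (filter-++ _ xs ys)) (length-++ (filterᵇ (_≡ᵇ j) xs))

count-concatMap : ∀ {A : Set} {n} j (g : A → List ℕ) (h : Fin n → A) →
                  count j (concatMap g (tabulate h)) ≡ ∑[ i < n ] count j (g (h i))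
count-concatMap {n = zero}  j g h = refl
count-concatMap {n = suc n} j g h =
  trans (count-++ j (g (h zero)) _) (cong (count j (g (h zero)) +_) (count-concatMap j g (h ∘ suc)))

sum-+ : ∀ a {b} (g : ℕ → ℕ) →
        ∑[ i < a + b ] g (toℕ i) ≡ ∑[ i < a ] g (toℕ i) + ∑[ i < b ] g (a + toℕ i)
sum-+ zero    g = refl
sum-+ (suc a) g = trans (cong (g 0 +_) (sum-+ a (g ∘ suc))) (sym (+-assoc (g 0) _ _))

sum-periodic : ∀ d q r (g : ℕ → ℕ) → (∀ m → g (d + m) ≡ g m) →
               ∑[ i < q * d + r ] g (toℕ i) ≡ q * ∑[ i < d ] g (toℕ i) + ∑[ i < r ] g (toℕ i)
sum-periodic d zero    r g period = refl
sum-periodic d (suc q) r g period = begin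
  ∑[ i < suc q * d + r ] g (toℕ i)    ≡⟨ cong (λ k → ∑[ i < k ] g (toℕ i)) (+-assoc d (q * d) r) ⟩
  ∑[ i < d + (q * d + r) ] g (toℕ i)  ≡⟨ sum-+ d g ⟩
  S + ∑[ i < q * d + r ] g (d + toℕ i)
    ≡⟨ cong (S +_) (sum-cong-≗ {q * d + r} (period ∘ toℕ)) ⟩
  S + ∑[ i < q * d + r ] g (toℕ i)    ≡⟨ cong (S +_) (sum-periodic d q r g period) ⟩
  S + (q * S + ∑[ i < r ] g (toℕ i))  ≡⟨ +-assoc S (q * S) _ ⟨
  suc q * S + ∑[ i < r ] g (toℕ i)    ∎
  where
  S : ℕ
  S = ∑[ i < d ] g (toℕ i)

next-inject₁ : ∀ {K} (i : Fin K) → next (inject₁ i) ≡ suc i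
next-inject₁ {K} i = toℕ-injective (begin
  toℕ (next (inject₁ i))         ≡⟨ toℕ-fromℕ< _ ⟩
  suc (toℕ (inject₁ i)) % suc K  ≡⟨ cong (λ m → suc m % suc K) (toℕ-inject₁ i) ⟩
  suc (toℕ i) % suc K            ≡⟨ m<n⇒m%n≡m (s≤s (toℕ<n i)) ⟩
  suc (toℕ i)                    ∎)

next-fromℕ : ∀ K → next (fromℕ K) ≡ zero
next-fromℕ K = toℕ-injective (begin
  toℕ (next (fromℕ K))         ≡⟨ toℕ-fromℕ< _ ⟩
  suc (toℕ (fromℕ K)) % suc K  ≡⟨ cong (λ m → suc m % suc K) (toℕ-fromℕ K) ⟩
  suc K % suc K                ≡⟨ n%n≡0 (suc K) ⟩
  0                            ∎)

sum-cyclic : ∀ {K} (c : Fin (suc K) → Fin (suc K) → ℕ) →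
             ∑[ i < suc K ] c i (next i) ≡ ∑[ i < K ] c (inject₁ i) (suc i) + c (fromℕ K) zero
sum-cyclic {K} c = trans (sum-init-last (λ i → c i (next i))) (cong₂ _+_
  (sum-cong-≗ {K} (λ i → cong (c (inject₁ i)) (next-inject₁ i)))
  (cong (c (fromℕ K)) (next-fromℕ K)))

vertexParity : ∀ {N} → (Fin N → Fin (suc N)) → Fin N → ℕ
vertexParity f v = fibParity (toℕ (f v))

edgeLabel-parity : ∀ G f (e : Fin (order G) × Fin (order G)) →
                   edgeLabel G f e ≡ (vertexParity f (proj₁ e) + vertexParity f (proj₂ e)) % 2
edgeLabel-parity G f (u , v) = trans (%-distribˡ-+ (fib (toℕ (f u))) (fib (toℕ (f v))) 2)
  (cong₂ (λ a b → (a + b) % 2) (fib%2≡fibParity (toℕ (f u))) (fib%2≡fibParity (toℕ (f v))))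

sectorLabels : ℕ → ℕ → ℕ → ℕ → ℕ → List ℕ
sectorLabels c x x′ y y′ = (c + x) % 2 ∷ (x + x′) % 2 ∷ (x + y) % 2 ∷ (y + y′) % 2 ∷ []

helmSectorCount : ∀ {n} → (Fin (suc (n + n)) → Fin (suc (suc (n + n)))) → ℕ → Fin n → Fin n → ℕ
helmSectorCount {n} f j x y =
  count j (sectorLabels (φ (apex n)) (φ (rim n x)) (φ (rim n y)) (φ (pendant n x)) (φ (pendant n y)))
  where φ = vertexParity f

ε-closedHelm : ∀ n f j → ε (closedHelm n) f j ≡ ∑[ i < n ] helmSectorCount f j i (next i)
ε-closedHelm n f j = begin
  ε G f j                                  ≡⟨ length-filterᵇ-map _ (edgeLabel G f) (edges G) ⟩
  count j (map (edgeLabel G f) (edges G))  ≡⟨ cong (count j) (map-cong (edgeLabel-parity G f) (edges G)) ⟩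
  count j (map L (edges G))                ≡⟨ cong (count j) (map-concatMap L sector (allFin n)) ⟩
  count j (concatMap (map L ∘ sector) (allFin n))
    ≡⟨ count-concatMap j (map L ∘ sector) id ⟩
  ∑[ i < n ] count j (map L (sector i))    ∎
  where
  G : Graph
  G = closedHelm n
  sector : Fin n → List (Fin (order G) × Fin (order G))
  sector i = (apex n , rim n i) ∷ (rim n i , rim n (next i)) ∷ (rim n i , pendant n i)
           ∷ (pendant n i , pendant n (next i)) ∷ []
  L : Fin (order G) × Fin (order G) → ℕ
  L (u , v) = (vertexParity f u + vertexParity f v) % 2

module _ {K : ℕ} where

  prev : Fin (suc K) → Fin (suc K)
  prev zero    = fromℕ K
  prev (suc i) = inject₁ i

  prev-injective : Injective _≡_ _≡_ prev
  prev-injective {zero}  {zero}  _ = refl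
  prev-injective {zero}  {suc j} e = contradiction e fromℕ≢inject₁
  prev-injective {suc i} {zero}  e = contradiction (sym e) fromℕ≢inject₁
  prev-injective {suc i} {suc j} e = cong suc (inject₁-injective e)

  rotate : ℕ → Fin (suc K) → Fin (suc K)
  rotate zero    i = i
  rotate (suc r) i = rotate r (prev i)

  rotate-injective : ∀ r → Injective _≡_ _≡_ (rotate r)
  rotate-injective zero    e = e
  rotate-injective (suc r) e = prev-injective (rotate-injective r e)

  toℕ-rotate-≥ : ∀ r (i : Fin (suc K)) → r ≤ toℕ i → toℕ (rotate r i) + r ≡ toℕ i
  toℕ-rotate-≥ zero    i       _         = +-identityʳ (toℕ i)
  toℕ-rotate-≥ (suc r) (suc i) (s≤s r≤i) = begin
    toℕ (rotate r (inject₁ i)) + suc r    ≡⟨ +-suc _ r ⟩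
    suc (toℕ (rotate r (inject₁ i)) + r)
      ≡⟨ cong suc (toℕ-rotate-≥ r (inject₁ i) (subst (r ≤_) (sym (toℕ-inject₁ i)) r≤i)) ⟩
    suc (toℕ (inject₁ i))                 ≡⟨ cong suc (toℕ-inject₁ i) ⟩
    suc (toℕ i)                           ∎

  toℕ-rotate-< : ∀ r (i : Fin (suc K)) → toℕ i < r → r ≤ suc K →
                 toℕ (rotate r i) + r ≡ toℕ i + suc K
  toℕ-rotate-< (suc r) zero    _         (s≤s r≤K) = begin
    toℕ (rotate r (fromℕ K)) + suc r    ≡⟨ +-suc _ r ⟩
    suc (toℕ (rotate r (fromℕ K)) + r)
      ≡⟨ cong suc (toℕ-rotate-≥ r (fromℕ K) (subst (r ≤_) (sym (toℕ-fromℕ K)) r≤K)) ⟩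
    suc (toℕ (fromℕ K))                 ≡⟨ cong suc (toℕ-fromℕ K) ⟩
    suc K                               ∎
  toℕ-rotate-< (suc r) (suc i) (s≤s i<r) (s≤s r≤K) = begin
    toℕ (rotate r (inject₁ i)) + suc r    ≡⟨ +-suc _ r ⟩
    suc (toℕ (rotate r (inject₁ i)) + r)
      ≡⟨ cong suc (toℕ-rotate-< r (inject₁ i) (subst (_< r) (sym (toℕ-inject₁ i)) i<r) (m≤n⇒m≤1+n r≤K)) ⟩
    suc (toℕ (inject₁ i) + suc K)         ≡⟨ cong (λ m → suc (m + suc K)) (toℕ-inject₁ i) ⟩
    suc (toℕ i + suc K)                   ∎

map₂-injective : ∀ {A B C : Set} {g : B → C} → Injective _≡_ _≡_ g → Injective _≡_ _≡_ (map₂ {A = A} g)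
map₂-injective g-injective {inj₁ x} {inj₁ y} e = cong inj₁ (inj₁-injective e)
map₂-injective g-injective {inj₂ x} {inj₂ y} e = cong inj₂ (g-injective (inj₂-injective e))

helmLabeling : ∀ K → ℕ → Fin (suc (suc K + suc K)) → Fin (suc (suc (suc K + suc K)))
helmLabeling K r zero    = zero
helmLabeling K r (suc v) = suc (suc (join (suc K) (suc K) (map₂ (rotate r) (splitAt (suc K) v))))

helmLabeling-injective : ∀ K r → Injective _≡_ _≡_ (helmLabeling K r)
helmLabeling-injective K r {zero}  {zero}  _ = refl
helmLabeling-injective K r {suc u} {suc v} e = cong suc (begin
  u                       ≡⟨ join-splitAt n n u ⟨
  join n n (splitAt n u)
    ≡⟨ cong (join n n) (map₂-injective (rotate-injective r) {splitAt n u} {splitAt n v} rotated≡) ⟩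
  join n n (splitAt n v)  ≡⟨ join-splitAt n n v ⟩
  v                       ∎)
  where
  n : ℕ
  n = suc K
  rotated≡ : map₂ (rotate r) (splitAt n u) ≡ map₂ (rotate r) (splitAt n v)
  rotated≡ = begin
    map₂ (rotate r) (splitAt n u)                         ≡⟨ splitAt-join n n _ ⟨
    splitAt n (join n n (map₂ (rotate r) (splitAt n u)))
      ≡⟨ cong (splitAt n) (suc-injective (suc-injective e)) ⟩
    splitAt n (join n n (map₂ (rotate r) (splitAt n v)))  ≡⟨ splitAt-join n n _ ⟩
    map₂ (rotate r) (splitAt n v)                         ∎

toℕ-helmLabeling-rim : ∀ K r i → toℕ (helmLabeling K r (rim (suc K) i)) ≡ 2 + toℕ i
toℕ-helmLabeling-rim K r i = cong (2 +_) (begin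
  toℕ (join n n (map₂ (rotate r) (splitAt n (i ↑ˡ n))))
    ≡⟨ cong (λ s → toℕ (join n n (map₂ (rotate r) s))) (splitAt-↑ˡ n i n) ⟩
  toℕ (i ↑ˡ n)  ≡⟨ toℕ-↑ˡ i n ⟩
  toℕ i         ∎)
  where
  n : ℕ
  n = suc K

toℕ-helmLabeling-pendant : ∀ K r i →
                           toℕ (helmLabeling K r (pendant (suc K) i)) ≡ 2 + (suc K + toℕ (rotate r i))
toℕ-helmLabeling-pendant K r i = cong (2 +_) (begin
  toℕ (join n n (map₂ (rotate r) (splitAt n (n ↑ʳ i))))
    ≡⟨ cong (λ s → toℕ (join n n (map₂ (rotate r) s))) (splitAt-↑ʳ n n i) ⟩
  toℕ (n ↑ʳ rotate r i)  ≡⟨ toℕ-↑ʳ n (rotate r i) ⟩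
  n + toℕ (rotate r i)   ∎)
  where
  n : ℕ
  n = suc K

rimParity : ℕ → ℕ
rimParity m = fibParity (2 + m)

pendantParity : ℕ → ℕ → ℕ
pendantParity r m = if does (m <? r) then rimParity (m + r) else rimParity m

pendantParity-< : ∀ {r m} → m < r → pendantParity r m ≡ rimParity (m + r)
pendantParity-< {r} {m} m<r =
  cong (λ b → if b then rimParity (m + r) else rimParity m) (dec-true (m <? r) m<r)

pendantParity-≥ : ∀ {r m} → r ≤ m → pendantParity r m ≡ rimParity m
pendantParity-≥ {r} {m} r≤m =
  cong (λ b → if b then rimParity (m + r) else rimParity m) (dec-false (m <? r) (≤⇒≯ r≤m))

sectorCount : ℕ → ℕ → ℕ → ℕ → ℕ
sectorCount j r m m′ =
  count j (sectorLabels 0 (rimParity m) (rimParity m′) (pendantParity r m) (pendantParity r m′))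

sectorCount-≥ : ∀ j {r m} → r ≤ m → sectorCount j r m (suc m) ≡ sectorCount j 0 m (suc m)
sectorCount-≥ j {r} {m} r≤m =
  cong₂ (λ y y′ → count j (sectorLabels 0 (rimParity m) (rimParity (suc m)) y y′))
        (pendantParity-≥ r≤m) (pendantParity-≥ (m≤n⇒m≤1+n r≤m))

bulkCount : ℕ → ℕ → ℕ
bulkCount j m = sectorCount j 0 (2 + m) (3 + m)

seamCount : ℕ → ℕ → ℕ
seamCount j r =
  count j (sectorLabels 0 (rimParity (2 + r)) (rimParity 0) (rimParity (2 + r)) (pendantParity r 0))

periodCount : ℕ → ℕ
periodCount j = ∑[ i < 3 ] bulkCount j (toℕ i)

boundaryCount : ℕ → ℕ → ℕ
boundaryCount j r =
  (sectorCount j r 0 1 + (sectorCount j r 1 2 + ∑[ i < r ] bulkCount j (toℕ i))) + seamCount j r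

boundaryCount-balanced : ∀ {r} → r < 3 → boundaryCount 0 r ≡ boundaryCount 1 r
boundaryCount-balanced {0} _ = refl
boundaryCount-balanced {1} _ = refl
boundaryCount-balanced {2} _ = refl
boundaryCount-balanced {suc (suc (suc _))} (s≤s (s≤s (s≤s ())))

fibonacciCordial : ∀ G f → Injective _≡_ _≡_ f → ε G f 0 ≡ ε G f 1 → FibonacciCordial G
fibonacciCordial G f f-injective ε₀≡ε₁ =
  f , f-injective , m≤n⇒m≤1+n (≤-reflexive ε₀≡ε₁) , m≤n⇒m≤1+n (≤-reflexive (sym ε₀≡ε₁))

module HelmCount (q r : ℕ) where

  K : ℕ
  K = 2 + (q * 3 + r)

  n : ℕ
  n = suc K

  f : Fin (suc (n + n)) → Fin (suc (suc (n + n)))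
  f = helmLabeling K r

  rimParity-+n : ∀ m → rimParity (m + n) ≡ rimParity (m + r)
  rimParity-+n m = trans (cong fibParity (shift q r m)) (fibParity-periodic (suc q) (2 + (m + r)))
    where
    shift : ∀ q r m → 2 + (m + (3 + (q * 3 + r))) ≡ suc q * 3 + (2 + (m + r))
    shift = solve-∀

  rim-parity : ∀ i → vertexParity f (rim n i) ≡ rimParity (toℕ i)
  rim-parity i = cong fibParity (toℕ-helmLabeling-rim K r i)

  pendant-parity-rotate : ∀ i → vertexParity f (pendant n i) ≡ rimParity (toℕ (rotate r i) + r)
  pendant-parity-rotate i = begin
    vertexParity f (pendant n i)      ≡⟨ cong fibParity (toℕ-helmLabeling-pendant K r i) ⟩
    rimParity (n + toℕ (rotate r i))  ≡⟨ cong rimParity (+-comm n _) ⟩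
    rimParity (toℕ (rotate r i) + n)  ≡⟨ rimParity-+n (toℕ (rotate r i)) ⟩
    rimParity (toℕ (rotate r i) + r)  ∎

  pendant-parity : ∀ i → vertexParity f (pendant n i) ≡ pendantParity r (toℕ i)
  pendant-parity i with toℕ i <? r
  ... | yes i<r = begin
    vertexParity f (pendant n i)      ≡⟨ pendant-parity-rotate i ⟩
    rimParity (toℕ (rotate r i) + r)  ≡⟨ cong rimParity (toℕ-rotate-< r i i<r (m≤n+m r (3 + q * 3))) ⟩
    rimParity (toℕ i + n)             ≡⟨ rimParity-+n (toℕ i) ⟩
    rimParity (toℕ i + r)             ≡⟨ pendantParity-< i<r ⟨
    pendantParity r (toℕ i)           ∎
  ... | no i≮r = begin
    vertexParity f (pendant n i)      ≡⟨ pendant-parity-rotate i ⟩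
    rimParity (toℕ (rotate r i) + r)  ≡⟨ cong rimParity (toℕ-rotate-≥ r i (≮⇒≥ i≮r)) ⟩
    rimParity (toℕ i)                 ≡⟨ pendantParity-≥ (≮⇒≥ i≮r) ⟨
    pendantParity r (toℕ i)           ∎

  sector-parity : ∀ j x y → helmSectorCount f j x y ≡ sectorCount j r (toℕ x) (toℕ y)
  sector-parity j x y rewrite rim-parity x | rim-parity y | pendant-parity x | pendant-parity y = refl

  ε-sectors : ∀ j → ε (closedHelm n) f j ≡
                    ∑[ i < K ] sectorCount j r (toℕ i) (suc (toℕ i)) + sectorCount j r K 0
  ε-sectors j = begin
    ε (closedHelm n) f j                                 ≡⟨ ε-closedHelm n f j ⟩
    ∑[ i < n ] c i (next i)                              ≡⟨ sum-cyclic c ⟩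
    ∑[ i < K ] c (inject₁ i) (suc i) + c (fromℕ K) zero  ≡⟨ cong₂ _+_ (sum-cong-≗ {K} inner) seam ⟩
    ∑[ i < K ] sectorCount j r (toℕ i) (suc (toℕ i)) + sectorCount j r K 0  ∎
    where
    c : Fin n → Fin n → ℕ
    c = helmSectorCount f j
    inner : ∀ i → c (inject₁ i) (suc i) ≡ sectorCount j r (toℕ i) (suc (toℕ i))
    inner i = trans (sector-parity j (inject₁ i) (suc i))
                    (cong (λ m → sectorCount j r m (suc (toℕ i))) (toℕ-inject₁ i))
    seam : c (fromℕ K) zero ≡ sectorCount j r K 0
    seam = trans (sector-parity j (fromℕ K) zero) (cong (λ m → sectorCount j r m 0) (toℕ-fromℕ K))

  ε≡period+boundary : r ≤ 2 → ∀ j → ε (closedHelm n) f j ≡ q * periodCount j + boundaryCount j r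
  ε≡period+boundary r≤2 j = begin
    ε (closedHelm n) f j  ≡⟨ ε-sectors j ⟩
    (s 0 1 + (s 1 2 + ∑[ i < q * 3 + r ] s (2 + toℕ i) (3 + toℕ i))) + s K 0
      ≡⟨ cong₂ (λ x y → (s 0 1 + (s 1 2 + x)) + y) bulk seam ⟩
    (s 0 1 + (s 1 2 + (q * periodCount j + ∑[ i < r ] bulkCount j (toℕ i)))) + seamCount j r
      ≡⟨ rearrange (s 0 1) (s 1 2) (q * periodCount j) _ (seamCount j r) ⟩
    q * periodCount j + boundaryCount j r  ∎
    where
    s : ℕ → ℕ → ℕ
    s = sectorCount j r
    bulk : ∑[ i < q * 3 + r ] s (2 + toℕ i) (3 + toℕ i) ≡
           q * periodCount j + ∑[ i < r ] bulkCount j (toℕ i)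
    bulk = trans (sum-cong-≗ {q * 3 + r} (λ i → sectorCount-≥ j (≤-trans r≤2 (m≤m+n 2 (toℕ i)))))
                 (sum-periodic 3 q r (bulkCount j) (λ _ → refl))
    rimParity-K : rimParity K ≡ rimParity (2 + r)
    rimParity-K = trans (cong fibParity (shift q r)) (fibParity-periodic q (4 + r))
      where
      shift : ∀ q r → 4 + (q * 3 + r) ≡ q * 3 + (4 + r)
      shift = solve-∀
    seam : s K 0 ≡ seamCount j r
    seam = cong₂ (λ x y → count j (sectorLabels 0 x (rimParity 0) y (pendantParity r 0)))
                 rimParity-K (trans (pendantParity-≥ (m≤n+m r (2 + q * 3))) rimParity-K)
    rearrange : ∀ a b x y w → (a + (b + (x + y))) + w ≡ x + ((a + (b + y)) + w)
    rearrange = solve-∀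

  cordial : r < 3 → FibonacciCordial (closedHelm n)
  cordial r<3 = fibonacciCordial (closedHelm n) f (helmLabeling-injective K r) (begin
    ε (closedHelm n) f 0                   ≡⟨ ε≡period+boundary (s≤s⁻¹ r<3) 0 ⟩
    q * periodCount 0 + boundaryCount 0 r  ≡⟨ cong (q * periodCount 0 +_) (boundaryCount-balanced r<3) ⟩
    q * periodCount 1 + boundaryCount 1 r  ≡⟨ ε≡period+boundary (s≤s⁻¹ r<3) 1 ⟨
    ε (closedHelm n) f 1                   ∎)

closedHelm-cordial : ∀ k → FibonacciCordial (closedHelm (3 + k))
closedHelm-cordial k =
  subst (FibonacciCordial ∘ closedHelm ∘ (3 +_)) k≡ (HelmCount.cordial (k / 3) (k % 3) (m%n<n k 3))
  where
  k≡ : k / 3 * 3 + k % 3 ≡ k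
  k≡ = trans (+-comm (k / 3 * 3) (k % 3)) (sym (m≡m%n+[m/n]*n k 3))

mainTheorem3 : (n : ℕ) → 3 ≤ n → FibonacciCordial (closedHelm n)
mainTheorem3 n 3≤n = subst (FibonacciCordial ∘ closedHelm) (m+[n∸m]≡n 3≤n) (closedHelm-cordial (n ∸ 3))
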